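{- Let $\mathbb{A}$ be either the equality atoms or the ordered atoms, let $\mathcal{G}=(V,V_\exists,R,\Omega)$ be an orbit-finite atomic parity game supported by a finite $S\subseteq\mathbb{A}$, and let $\mathcal{G}/S=(V/S,V_\exists/S,R/S,\Omega/S)$ be its orbit game. View $\mathcal{G}$ as the Kripke model with states $V$, transition relation $R$ and basic predicates $\mathbb{N}$ with $v\models n$ iff $\Omega(v)=n$, and view $\mathcal{G}/S$ analogously. Then the quotient function $\Pi:V\to V/S$, $\Pi(v)=[v]$, is a bisimulation between these two Kripke models.
   Context: Atoms: either (equality atoms) $\mathbb{A}$ is a countably infinite set and $\mathrm{Aut}(\mathbb{A})$ is the group of all its bijections, or (ordered atoms) $\mathbb{A}=\mathbb{Q}$ and $\mathrm{Aut}(\mathbb{A})$ is the group of order-preserving bijections. Sets with atoms are built hereditarily from atoms; $\mathrm{Aut}(\mathbb{A})$ acts on them by renaming atoms; a finite $S$ supports $x$ if every automorphism fixing $S$ pointwise fixes $x$; only hereditarily finitely supported sets are considered. The $S$-orbit of $x$ is $[x]=\{x\cdot\pi:\pi$ fixes $S$ pointwise$\}$; an $S$-supported set is orbit-finite if it is a finite union of $S$-orbits. An atomic parity game is $\mathcal{G}=(V,V_\exists,R,\Omega)$ where $V$ is a set with atoms, $V_\exists\subseteq V$ and $R\subseteq V^2$ are finitely supported, and $\Omega:V\to\mathbb{N}$ is bounded and finitely supported; $S$ supports $\mathcal{G}$ if it supports $V,V_\exists,R,\Omega$; $\mathcal{G}$ is orbit-finite if $V$ is. The orbit game $\mathcal{G}/S$: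 $V/S$ and $V_\exists/S$ are the sets of $S$-orbits of $V$ and $V_\exists$; $([v],[w])\in R/S$ iff $(x,y)\in R$ for some $x\in[v]$, $y\in[w]$; $(\Omega/S)([v])=\Omega(x)$ for any $x\in[v]$. A (classical) bisimulation between Kripke models $(K_1,\to_1,\models_1)$ and $(K_2,\to_2,\models_2)$ is a relation $Z\subseteq K_1\times K_2$ such that whenever $uZv$: $u$ and $v$ satisfy the same basic predicates; for every $u\to_1u'$ there is $v\to_2v'$ with $u'Zv'$; and for every $v\to_2v'$ there is $u\to_1u'$ with $u'Zv'$. A function is a bisimulation if its graph is. -}

module Defs where

open import Data.Nat using (ℕ; _≤_)
open import Data.Rational using (ℚ; _<_)
open import Data.Product using (Σ; ∃; _×_; _,_; proj₁; proj₂)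
open import Data.List using (List)
open import Data.List.Relation.Unary.All using (All)
open import Data.List.Relation.Unary.Any using (Any)
open import Function using (_∘_)
open import Function.Bundles using (_↔_; Inverse)
open import Function.Construct.Composition using (_↔-∘_)
open import Function.Construct.Identity using (↔-id)
open import Relation.Binary.PropositionalEquality using (_≡_)

data AtomKind : Set where
  equality : AtomKind
  ordered  : AtomKind

Atom : AtomKind → Set
Atom equality = ℕ
Atom ordered  = ℚ

OrdAut : Set
OrdAut = Σ (ℚ ↔ ℚ) (λ f → ∀ {p q} → p < q → Inverse.to f p < Inverse.to f q)

Aut : AtomKind → Set
Aut equality = ℕ ↔ ℕ
Aut ordered  = OrdAut

app : ∀ {k} → Aut k → Atom k → Atom k
app {equality} π a = Inverse.to π a
app {ordered}  π a = Inverse.to (proj₁ π) a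

idAut : ∀ {k} → Aut k
idAut {equality} = ↔-id ℕ
idAut {ordered}  = ↔-id ℚ , λ p<q → p<q

-- (π ⨾ σ) a = σ (π a)   (first π, then σ)
_⨾_ : ∀ {k} → Aut k → Aut k → Aut k
_⨾_ {equality} π σ = σ ↔-∘ π
_⨾_ {ordered}  (π , mπ) (σ , mσ) = (σ ↔-∘ π) , (mσ ∘ mπ)

Fixes : ∀ {k} → List (Atom k) → Aut k → Set
Fixes S π = All (λ a → app π a ≡ a) S

-- A universe of sets with atoms: a type with a (right) action of Aut(𝔸)
-- by renaming, in which every element is finitely supported.

record AtomUniverse (k : AtomKind) : Set₁ where
  field
    U     : Set
    _·_   : U → Aut k → U
    ·-id  : ∀ x → x · idAut ≡ x
    ·-⨾   : ∀ x π σ → x · (π ⨾ σ) ≡ (x · π) · σ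
    ·-ext : ∀ x π σ → (∀ a → app π a ≡ app σ a) → x · π ≡ x · σ

  Supports : List (Atom k) → U → Set
  Supports S x = ∀ π → Fixes S π → x · π ≡ x

  field
    finSupp : ∀ x → ∃ λ S → Supports S x



module _ {k : AtomKind} (𝕌 : AtomUniverse k) where
  open AtomUniverse 𝕌 using (U; _·_)

  _∈Orb[_]_ : U → List (Atom k) → U → Set
  y ∈Orb[ S ] x = ∃ λ π → Fixes S π × y ≡ x · π

  SupportsPred : List (Atom k) → (U → Set) → Set
  SupportsPred S P = ∀ π → Fixes S π → ∀ x → (P x → P (x · π)) × (P (x · π) → P x)

  SupportsRel : List (Atom k) → (U → U → Set) → Set
  SupportsRel S R = ∀ π → Fixes S π → ∀ x y →
    (R x y → R (x · π) (y · π)) × (R (x · π) (y · π) → R x y)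

-- Atomic parity games (V ⊆ U, V∃ ⊆ V, R ⊆ V², Ω : V → ℕ; Ω is given
-- as a function on U of which only the values on V matter)

record ParityGame {k : AtomKind} (𝕌 : AtomUniverse k) : Set₁ where
  open AtomUniverse 𝕌 using (U)
  field
    V     : U → Set
    V∃    : U → Set
    R     : U → U → Set
    Ω     : U → ℕ
    V∃⊆V  : ∀ x → V∃ x → V x
    R⊆V²  : ∀ x y → R x y → V x × V y
    Ω-bounded : ∃ λ b → ∀ x → V x → Ω x ≤ b

module _ {k : AtomKind} {𝕌 : AtomUniverse k} where
  open AtomUniverse 𝕌 using (U; _·_)

  -- S supports the game: it supports V, V∃, R and Ω (Ω as a set of pairs)
  SupportsGame : List (Atom k) → ParityGame 𝕌 → Set
  SupportsGame S 𝒢 =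
    SupportsPred 𝕌 S V × SupportsPred 𝕌 S V∃ × SupportsRel 𝕌 S R ×
    (∀ π → Fixes S π → ∀ x → V x → Ω (x · π) ≡ Ω x)
    where open ParityGame 𝒢

  OrbitFinite : List (Atom k) → ParityGame 𝕌 → Set
  OrbitFinite S 𝒢 = ∃ λ (reps : List U) →
    All V reps × (∀ x → V x → Any (λ r → _∈Orb[_]_ 𝕌 x S r) reps)
    where open ParityGame 𝒢

record Kripke : Set₁ where
  field
    K   : Set
    _⟶_ : K → K → Set
    _⊨_ : K → ℕ → Set

IsBisimulation : (M₁ M₂ : Kripke) → (Kripke.K M₁ → Kripke.K M₂ → Set) → Set
IsBisimulation M₁ M₂ Z = ∀ u v → Z u v →
    (∀ n → (u ⊨₁ n → v ⊨₂ n) × (v ⊨₂ n → u ⊨₁ n))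
  × (∀ u' → u ⟶₁ u' → ∃ λ v' → v ⟶₂ v' × Z u' v')
  × (∀ v' → v ⟶₂ v' → ∃ λ u' → u ⟶₁ u' × Z u' v')
  where
  open Kripke M₁ renaming (_⟶_ to _⟶₁_; _⊨_ to _⊨₁_)
  open Kripke M₂ renaming (_⟶_ to _⟶₂_; _⊨_ to _⊨₂_)

module _ {k : AtomKind} {𝕌 : AtomUniverse k} where
  open AtomUniverse 𝕌 using (U)

  GameKripke : ParityGame 𝕌 → Kripke
  GameKripke 𝒢 = record
    { K   = Σ U V
    ; _⟶_ = λ v w → R (proj₁ v) (proj₁ w)
    ; _⊨_ = λ v n → Ω (proj₁ v) ≡ n }
    where open ParityGame 𝒢

  -- No quotient types are available, so an
  -- S-orbit [v] ∈ V/S is represented by any of its elements v ∈ V;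
  -- all structure below depends only on the orbit [v]:
  --   [v] ⟶ [w]  iff  (x,y) ∈ R for some x ∈ [v], y ∈ [w]
  --   [v] ⊨ n    iff  (Ω/S)([v]) = n, where (Ω/S)([v]) = Ω x for x ∈ [v]
  OrbitKripke : List (Atom k) → ParityGame 𝕌 → Kripke
  OrbitKripke S 𝒢 = record
    { K   = Σ U V
    ; _⟶_ = λ v w → ∃ λ x → ∃ λ y →
              _∈Orb[_]_ 𝕌 x S (proj₁ v) × _∈Orb[_]_ 𝕌 y S (proj₁ w) × R x y
    ; _⊨_ = λ v n → ∃ λ x → _∈Orb[_]_ 𝕌 x S (proj₁ v) × Ω x ≡ n }
    where open ParityGame 𝒢

  -- graph of the quotient map Π(v) = [v]: v is related to (a representative
  -- of) the orbit [r] iff [r] = [v], i.e. r ∈ [v]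
  ΠGraph : (S : List (Atom k)) (𝒢 : ParityGame 𝕌) →
           Kripke.K (GameKripke 𝒢) → Kripke.K (OrbitKripke S 𝒢) → Set
  ΠGraph S 𝒢 v r = _∈Orb[_]_ 𝕌 (proj₁ r) S (proj₁ v)

module Submission where

-- The automorphisms fixing S pointwise form a group acting on
-- the universe, so "y lies in the S-orbit of x" is an equivalence relation.
-- Because S supports the game, Ω is constant on S-orbits, and an edge
-- a → b whose source lies in the orbit of x can be moved, by the inverse of
-- the renaming that takes x to a, to an edge x → b' with b' in the orbit of b.
--   * Predicates: v and [v] carry the same priority since Ω is orbit-invariant.
--   * Forth: an edge v → v' gives the orbit edge [v] → [v'] directly.
--   * Back: an orbit edge [v] → [w] is witnessed by some a → b with a ∈ [v],
--     b ∈ [w]; lifting it gives v → b' with [b'] = [w].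

open import Defs
open import Data.List using (List; []; _∷_)
open import Data.List.Relation.Unary.All using ([]; _∷_)
open import Data.Product using (∃; _×_; _,_; proj₁; proj₂)
open import Data.Rational using (_<_)
open import Data.Rational.Properties using (<-cmp; <-asym; <-irrefl)
open import Data.Empty using (⊥-elim)
open import Relation.Binary.Definitions using (tri<; tri≈; tri>)
open import Function.Bundles using (Inverse)
open import Function.Construct.Symmetry using (↔-sym)
open import Relation.Binary.PropositionalEquality
  using (_≡_; refl; sym; trans; cong; subst; subst₂; module ≡-Reasoning)

-- Inverse automorphism.  For ordered atoms the inverse of an
-- order-preserving bijection of ℚ is again order-preserving, since ℚ is a
-- strict total order.
inv : ∀ {k} → Aut k → Aut k
inv {equality} π = ↔-sym π
inv {ordered} (π , mono) = ↔-sym π , mono⁻¹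
  where
  open Inverse π
  mono⁻¹ : ∀ {p q} → p < q → from p < from q
  mono⁻¹ {p} {q} p<q with <-cmp (from p) (from q)
  ... | tri< lt _ _ = lt
  ... | tri≈ _ eq _ = ⊥-elim (<-irrefl p≡q p<q)
    where
    p≡q : p ≡ q
    p≡q = trans (sym (strictlyInverseˡ p)) (trans (cong to eq) (strictlyInverseˡ q))
  ... | tri> _ _ gt =
    ⊥-elim (<-asym p<q (subst₂ _<_ (strictlyInverseˡ q) (strictlyInverseˡ p) (mono gt)))

app-inv : ∀ {k} (π : Aut k) a → app (inv π) (app π a) ≡ a
app-inv {equality} π a = Inverse.strictlyInverseʳ π a
app-inv {ordered}  π a = Inverse.strictlyInverseʳ (proj₁ π) a

app-id : ∀ {k} (a : Atom k) → app idAut a ≡ a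
app-id {equality} a = refl
app-id {ordered}  a = refl

app-⨾ : ∀ {k} (π σ : Aut k) a → app (π ⨾ σ) a ≡ app σ (app π a)
app-⨾ {equality} π σ a = refl
app-⨾ {ordered}  π σ a = refl

fixes-id : ∀ {k} (S : List (Atom k)) → Fixes S idAut
fixes-id []      = []
fixes-id (a ∷ S) = app-id a ∷ fixes-id S

fixes-inv : ∀ {k S} (π : Aut k) → Fixes S π → Fixes S (inv π)
fixes-inv π [] = []
fixes-inv π (_∷_ {x = a} πa≡a f) =
  trans (cong (app (inv π)) (sym πa≡a)) (app-inv π a) ∷ fixes-inv π f

fixes-⨾ : ∀ {k S} (π σ : Aut k) → Fixes S π → Fixes S σ → Fixes S (π ⨾ σ)
fixes-⨾ π σ [] [] = []
fixes-⨾ π σ (_∷_ {x = a} πa≡a f) (σa≡a ∷ g) =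
  trans (app-⨾ π σ a) (trans (cong (app σ) πa≡a) σa≡a) ∷ fixes-⨾ π σ f g

module Orbits {k : AtomKind} (𝕌 : AtomUniverse k) (S : List (Atom k)) where
  open AtomUniverse 𝕌

  infix 4 _∼_
  _∼_ : U → U → Set
  y ∼ x = _∈Orb[_]_ 𝕌 y S x

  ·-inv : ∀ x (π : Aut k) → (x · π) · inv π ≡ x
  ·-inv x π = begin
    (x · π) · inv π  ≡⟨ sym (·-⨾ x π (inv π)) ⟩
    x · (π ⨾ inv π)  ≡⟨ ·-ext x _ idAut πinv≗id ⟩
    x · idAut        ≡⟨ ·-id x ⟩
    x                ∎
    where
    open ≡-Reasoning
    πinv≗id : ∀ a → app (π ⨾ inv π) a ≡ app idAut a
    πinv≗id a = trans (app-⨾ π (inv π) a) (trans (app-inv π a) (sym (app-id a)))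

  ∼-refl : ∀ x → x ∼ x
  ∼-refl x = idAut , fixes-id S , sym (·-id x)

  ∼-sym : ∀ {x y} → y ∼ x → x ∼ y
  ∼-sym {x} (π , fπ , refl) = inv π , fixes-inv π fπ , sym (·-inv x π)

  ∼-trans : ∀ {x y z} → z ∼ y → y ∼ x → z ∼ x
  ∼-trans {x} (τ , fτ , refl) (π , fπ , refl) =
    π ⨾ τ , fixes-⨾ π τ fπ fτ , sym (·-⨾ x π τ)

  ·-∼ : ∀ x π → Fixes S π → x · π ∼ x
  ·-∼ x π fπ = π , fπ , refl

  module _ (𝒢 : ParityGame 𝕌) where
    open ParityGame 𝒢

    Ω-orbit : (∀ π → Fixes S π → ∀ x → V x → Ω (x · π) ≡ Ω x) →
              ∀ {x y} → V x → y ∼ x → Ω y ≡ Ω x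
    Ω-orbit Ω-inv Vx (π , fπ , refl) = Ω-inv π fπ _ Vx

    -- An edge a → b with a in the orbit of x yields an edge x → b' with
    -- b' in the orbit of b: rename by the inverse of the map taking x to a.
    lift-edge : SupportsRel 𝕌 S R → ∀ {x a b} → a ∼ x → R a b →
                ∃ λ b' → R x b' × b' ∼ b
    lift-edge R-inv {x} {b = b} (π , fπ , refl) r =
      b · inv π ,
      subst (λ z → R z (b · inv π)) (·-inv x π)
            (proj₁ (R-inv (inv π) (fixes-inv π fπ) _ b) r) ,
      ·-∼ b (inv π) (fixes-inv π fπ)

lemma7p3 : (k : AtomKind) (𝕌 : AtomUniverse k) (𝒢 : ParityGame 𝕌)
    (S : List (Atom k)) → SupportsGame S 𝒢 → OrbitFinite S 𝒢 →
    IsBisimulation (GameKripke 𝒢) (OrbitKripke S 𝒢) (ΠGraph S 𝒢)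
lemma7p3 k 𝕌 𝒢 S (_ , _ , R-inv , Ω-inv) _ (x , Vx) (y , Vy) y∼x =
  same-priority , forth , back
  where
  open ParityGame 𝒢
  open Orbits 𝕌 S

  same-priority : ∀ n → (Ω x ≡ n → ∃ λ z → z ∼ y × Ω z ≡ n)
                      × (∃ (λ z → z ∼ y × Ω z ≡ n) → Ω x ≡ n)
  same-priority n =
    (λ Ωx≡n → x , ∼-sym y∼x , Ωx≡n)
    , λ { (z , z∼y , Ωz≡n) →
          trans (sym (Ω-orbit 𝒢 Ω-inv Vx (∼-trans z∼y y∼x))) Ωz≡n }

  forth : ∀ x' → R x (proj₁ x') →
          ∃ λ y' → (∃ λ a → ∃ λ b → a ∼ y × b ∼ proj₁ y' × R a b)
                 × proj₁ y' ∼ proj₁ x'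
  forth (x' , Vx') r = (x' , Vx') , (x , x' , ∼-sym y∼x , ∼-refl x' , r) , ∼-refl x'

  back : ∀ y' → (∃ λ a → ∃ λ b → a ∼ y × b ∼ proj₁ y' × R a b) →
         ∃ λ x' → R x (proj₁ x') × proj₁ y' ∼ proj₁ x'
  back (y' , _) (a , b , a∼y , b∼y' , r)
    with lift-edge 𝒢 R-inv (∼-trans a∼y y∼x) r
  ... | b' , xRb' , b'∼b =
    (b' , proj₂ (R⊆V² x b' xRb')) , xRb' , ∼-sym (∼-trans b'∼b b∼y')
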